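{- Let $A=(a_{ij})$ be an $l\times l$ complex matrix, $\lambda=(\lambda_1,\ldots,\lambda_l)\in\mathbb{C}^l$ and $\mathbf{d}=(d_1,\ldots,d_l)$ positive integers. Let $M(A,\lambda,\mathbf d)=(a_{ij}J_{d_id_j})_{1\leq i,j\leq l}+\mathrm{diag}(\lambda_1I_{d_1},\ldots,\lambda_lI_{d_l})$ (a square matrix of size $d_1+\cdots+d_l$) and $\bar M(A,\lambda,\mathbf d)=\mathrm{diag}(d_1,\ldots,d_l)A+\mathrm{diag}(\lambda_1,\ldots,\lambda_l)$. Then $$\chi_{M(A,\lambda,\mathbf d)}(t)=\chi_{\bar M(A,\lambda,\mathbf d)}(t)\prod_{i=1}^l(t-\lambda_i)^{d_i-1},\qquad \det M(A,\lambda,\mathbf d)=\det\bar M(A,\lambda,\mathbf d)\prod_{i=1}^l\lambda_i^{d_i-1}.$$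
   Context: $J_{pq}$ is the $p\times q$ all-ones matrix, $I_p$ the identity matrix, $\mathrm{diag}$ a (block) diagonal matrix, and $\chi_X(t)=\det(tI-X)$. -}

module Defs where

open import Level using (Level)
open import Data.Nat using (ℕ; zero; suc)
import Data.Nat as ℕ
open import Data.Fin using (Fin; zero; suc; splitAt; punchIn; _≟_)
open import Data.Sum using (inj₁; inj₂)
open import Relation.Nullary using (yes; no)
open import Function using (_∘_)
open import Algebra.Bundles using (CommutativeRing)

total : ∀ {l} → (Fin l → ℕ) → ℕ
total {zero}  d = 0
total {suc l} d = d zero ℕ.+ total (d ∘ suc)

-- the block (1..l) that an index of the big matrix belongs to,
-- with blocks ordered consecutively: first d₁ indices in block 1, etc.
block : ∀ {l} (d : Fin l → ℕ) → Fin (total d) → Fin l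
block {zero}  d ()
block {suc l} d x with splitAt (d zero) x
... | inj₁ _ = zero
... | inj₂ y = suc (block (d ∘ suc) y)

module _ {c ℓ : Level} (R : CommutativeRing c ℓ) where
  open CommutativeRing R using (Carrier; 0#; 1#; _+_; _*_; -_; _-_)

  Matrix : ℕ → Set c
  Matrix n = Fin n → Fin n → Carrier

  sumF : ∀ {n} → (Fin n → Carrier) → Carrier
  sumF {zero}  f = 0#
  sumF {suc n} f = f zero + sumF (f ∘ suc)

  prodF : ∀ {n} → (Fin n → Carrier) → Carrier
  prodF {zero}  f = 1#
  prodF {suc n} f = f zero * prodF (f ∘ suc)

  pow : Carrier → ℕ → Carrier
  pow x zero    = 1#
  pow x (suc k) = x * pow x k

  fromℕ : ℕ → Carrier
  fromℕ zero    = 0#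
  fromℕ (suc k) = 1# + fromℕ k

  sgn : ∀ {n} → Fin n → Carrier
  sgn zero    = 1#
  sgn (suc j) = - sgn j

  δ : ∀ {n} → Fin n → Fin n → Carrier → Carrier
  δ p q x with p ≟ q
  ... | yes _ = x
  ... | no  _ = 0#

  det : ∀ {n} → Matrix n → Carrier
  det {zero}  M = 1#
  det {suc n} M =
    sumF (λ j → sgn j * (M zero j * det (λ p q → M (suc p) (punchIn j q))))

  charPoly : ∀ {n} → Matrix n → Carrier → Carrier
  charPoly X t = det (λ p q → δ p q t - X p q)

  bigM : ∀ {l} → Matrix l → (Fin l → Carrier) → (d : Fin l → ℕ) → Matrix (total d)
  bigM A λ' d p q = A (block d p) (block d q) + δ p q (λ' (block d p))

  barM : ∀ {l} → Matrix l → (Fin l → Carrier) → (Fin l → ℕ) → Matrix l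
  barM A λ' d i j = fromℕ (d i) * A i j + δ i j (λ' i)

module Submission where

-- Label each row of M(A,λ,d) by its block: a row with label i and weight w has entries
-- w · a_{i,label q} + δ_{pq} λ_i.  Two adjacent rows with the same label i and weights a, b
-- can be replaced by a single row of weight a + b at the cost of a factor λ_i: expanding
-- both rows linearly, the term with two copies of (a_{i,label q})_q vanishes and what
-- remains is λ_i times the determinant with the merged row.  Merging the d_i rows of each
-- block and moving the merged row to the end (a simultaneous permutation of rows and
-- columns) turns det M(A,λ,d) into ∏ λ_i^{d_i-1} · det M̄(A,λ,d).  The identity for
-- characteristic polynomials is the same statement for -A and t - λ.

open import Defs
open import Data.Nat as ℕ using (ℕ; zero; suc; _≤_; _∸_)
import Data.Nat.Properties as ℕP
open import Data.Fin as F using (Fin; zero; suc; punchIn; _≟_; _↑ˡ_; _↑ʳ_)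
import Data.Fin.Properties as FP
open import Data.Integer as ℤ using (ℤ; +_; -[1+_]; _⊖_; _◃_)
import Data.Integer.Properties as ℤP
open import Data.Sign as Sign using ()
open import Data.Maybe using (Maybe; just; nothing)
open import Data.Product using (_×_; _,_; proj₁; proj₂)
open import Data.Vec as V using (Vec; []; _∷_; _∷ʳ_; lookup; tabulate; fromList; toList)
import Data.Vec.Properties as VP
open import Data.List as L using (List; []; _∷_; _++_; [_]; replicate; length)
import Data.List.Properties as LP
open import Data.Empty using (⊥-elim)
open import Function using (_∘_; id)
open import Relation.Binary.PropositionalEquality as P using (_≡_)
open import Relation.Nullary using (yes; no)
open import Algebra.Bundles using (CommutativeRing)
import Algebra.Solver.Ring.AlmostCommutativeRing as ACR

-- The ring solver needs coefficients whose equality it can decide; ℤ maps into every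
-- commutative ring.  With the optimised multiplication `_·_`, `1 · 1#` reduces to `1#`,
-- so the solver constant `con (+ 1)` denotes `1#` itself.
module IntegerCoefficientSolver {c ℓ} (R : CommutativeRing c ℓ) where
  open CommutativeRing R
  open import Algebra.Properties.Ring ring using (-‿distribˡ-*; -‿distribʳ-*; -‿involutive; -0#≈0#)
  open import Algebra.Properties.AbelianGroup +-abelianGroup using (⁻¹-∙-comm)
  open import Algebra.Properties.Semiring.Mult.TCOptimised semiring using (1+×; ×-homo-+; ×1-homo-*) renaming (_×_ to _·_)
  open import Relation.Binary.Reasoning.Setoid setoid

  fromℤ : ℤ → Carrier
  fromℤ (+ n)    = n · 1#
  fromℤ -[1+ n ] = - (suc n · 1#)

  fromℤ-⊖ : ∀ m n → fromℤ (m ⊖ n) ≈ m · 1# - n · 1#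
  fromℤ-⊖ zero    zero    = sym (-‿inverseʳ 0#)
  fromℤ-⊖ (suc m) zero    = sym (trans (+-congˡ -0#≈0#) (+-identityʳ _))
  fromℤ-⊖ zero    (suc n) = sym (+-identityˡ _)
  fromℤ-⊖ (suc m) (suc n) = begin
    fromℤ (suc m ⊖ suc n)                    ≡⟨ P.cong fromℤ (ℤP.[1+m]⊖[1+n]≡m⊖n m n) ⟩
    fromℤ (m ⊖ n)                            ≈⟨ fromℤ-⊖ m n ⟩
    m · 1# - n · 1#                          ≈⟨ +-congʳ (+-identityˡ _) ⟨
    (0# + m · 1#) - n · 1#                   ≈⟨ +-congʳ (+-congʳ (-‿inverseʳ 1#)) ⟨
    ((1# - 1#) + m · 1#) - n · 1#            ≈⟨ +-congʳ (trans (+-congʳ (+-comm _ _)) (+-assoc _ _ _)) ⟩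
    (- 1# + (1# + m · 1#)) - n · 1#          ≈⟨ trans (+-congʳ (+-comm _ _)) (+-assoc _ _ _) ⟩
    (1# + m · 1#) + (- 1# - n · 1#)          ≈⟨ +-congˡ (⁻¹-∙-comm 1# (n · 1#)) ⟩
    (1# + m · 1#) - (1# + n · 1#)            ≈⟨ +-cong (1+× m 1#) (-‿cong (1+× n 1#)) ⟨
    suc m · 1# - suc n · 1#                  ∎

  fromℤ-+ : ∀ i j → fromℤ (i ℤ.+ j) ≈ fromℤ i + fromℤ j
  fromℤ-+ (+ m)    (+ n)    = ×-homo-+ 1# m n
  fromℤ-+ (+ m)    -[1+ n ] = fromℤ-⊖ m (suc n)
  fromℤ-+ -[1+ m ] (+ n)    = trans (fromℤ-⊖ n (suc m)) (+-comm _ _)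
  fromℤ-+ -[1+ m ] -[1+ n ] = begin
    - (suc (suc (m ℕ.+ n)) · 1#)         ≡⟨ P.cong (λ k → - (suc k · 1#)) (ℕP.+-suc m n) ⟨
    - ((suc m ℕ.+ suc n) · 1#)           ≈⟨ -‿cong (×-homo-+ 1# (suc m) (suc n)) ⟩
    - (suc m · 1# + suc n · 1#)          ≈⟨ ⁻¹-∙-comm _ _ ⟨
    - (suc m · 1#) - (suc n · 1#)        ∎

  fromℤ-◃⁺ : ∀ k → fromℤ (Sign.+ ◃ k) ≈ k · 1#
  fromℤ-◃⁺ zero    = refl
  fromℤ-◃⁺ (suc k) = refl

  fromℤ-◃⁻ : ∀ k → fromℤ (Sign.- ◃ k) ≈ - (k · 1#)
  fromℤ-◃⁻ zero    = sym -0#≈0#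
  fromℤ-◃⁻ (suc k) = refl

  fromℤ-* : ∀ i j → fromℤ (i ℤ.* j) ≈ fromℤ i * fromℤ j
  fromℤ-* (+ m)    (+ n)    = trans (fromℤ-◃⁺ (m ℕ.* n)) (×1-homo-* m n)
  fromℤ-* (+ m)    -[1+ n ] = trans (fromℤ-◃⁻ (m ℕ.* suc n))
                                (trans (-‿cong (×1-homo-* m (suc n))) (-‿distribʳ-* _ _))
  fromℤ-* -[1+ m ] (+ n)    = trans (fromℤ-◃⁻ (suc m ℕ.* n))
                                (trans (-‿cong (×1-homo-* (suc m) n)) (-‿distribˡ-* _ _))
  fromℤ-* -[1+ m ] -[1+ n ] = begin
    (suc m ℕ.* suc n) · 1#                   ≈⟨ ×1-homo-* (suc m) (suc n) ⟩
    suc m · 1# * suc n · 1#                  ≈⟨ -‿involutive _ ⟨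
    - - (suc m · 1# * suc n · 1#)            ≈⟨ -‿cong (-‿distribʳ-* _ _) ⟩
    - (suc m · 1# * - (suc n · 1#))          ≈⟨ -‿distribˡ-* _ _ ⟩
    - (suc m · 1#) * - (suc n · 1#)          ∎

  fromℤ-neg : ∀ i → fromℤ (ℤ.- i) ≈ - fromℤ i
  fromℤ-neg (+ zero)  = sym -0#≈0#
  fromℤ-neg (+ suc n) = refl
  fromℤ-neg -[1+ n ]  = sym (-‿involutive _)

  homomorphism : ACR._-Raw-AlmostCommutative⟶_ ℤ.+-*-rawRing (ACR.fromCommutativeRing R)
  homomorphism = record
    { ⟦_⟧    = fromℤ
    ; +-homo = fromℤ-+
    ; *-homo = fromℤ-*
    ; -‿homo = fromℤ-neg
    ; 0-homo = refl
    ; 1-homo = refl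
    }

  fromℤ-≟ : ∀ i j → Maybe (fromℤ i ≈ fromℤ j)
  fromℤ-≟ i j with i ℤ.≟ j
  ... | yes P.refl = just refl
  ... | no _       = nothing

  open import Algebra.Solver.Ring ℤ.+-*-rawRing (ACR.fromCommutativeRing R) homomorphism fromℤ-≟ public

swapAt : ∀ {n} → Fin n → Fin (suc n) → Fin (suc n)
swapAt zero    zero          = suc zero
swapAt zero    (suc zero)    = zero
swapAt zero    (suc (suc q)) = suc (suc q)
swapAt (suc i) q             = F.lift 1 (swapAt i) q

swapAt-involutive : ∀ {n} (i : Fin n) q → swapAt i (swapAt i q) ≡ q
swapAt-involutive zero    zero          = P.refl
swapAt-involutive zero    (suc zero)    = P.refl
swapAt-involutive zero    (suc (suc q)) = P.refl
swapAt-involutive (suc i) zero          = P.refl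
swapAt-involutive (suc i) (suc q)       = P.cong suc (swapAt-involutive i q)

swapAll : ∀ {m} → List (Fin m) → Fin (suc m) → Fin (suc m)
swapAll []       q = q
swapAll (i ∷ is) q = swapAt i (swapAll is q)

swapAll-injective : ∀ {m} (is : List (Fin m)) {p q} → swapAll is p ≡ swapAll is q → p ≡ q
swapAll-injective []       eq = eq
swapAll-injective (i ∷ is) {p} {q} eq = swapAll-injective is (begin
  swapAll is p                       ≡⟨ swapAt-involutive i _ ⟨
  swapAt i (swapAt i (swapAll is p)) ≡⟨ P.cong (swapAt i) eq ⟩
  swapAt i (swapAt i (swapAll is q)) ≡⟨ swapAt-involutive i _ ⟩
  swapAll is q                       ∎)
  where open P.≡-Reasoning

swapAll-map-suc : ∀ {m} (is : List (Fin m)) q → swapAll (L.map suc is) q ≡ F.lift 1 (swapAll is) q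
swapAll-map-suc []       zero    = P.refl
swapAll-map-suc []       (suc q) = P.refl
swapAll-map-suc (i ∷ is) zero    = P.cong (F.lift 1 (swapAt i)) (swapAll-map-suc is zero)
swapAll-map-suc (i ∷ is) (suc q) = P.cong (F.lift 1 (swapAt i)) (swapAll-map-suc is (suc q))

rotation : (m : ℕ) → List (Fin m)
rotation zero    = []
rotation (suc m) = zero ∷ L.map suc (rotation m)

lookup-∷ʳ-rotation : ∀ {a} {A : Set a} {m} (v : Vec A m) x p →
                     lookup (v ∷ʳ x) p ≡ lookup (x ∷ v) (swapAll (rotation m) p)
lookup-∷ʳ-rotation []      x zero    = P.refl
lookup-∷ʳ-rotation {m = suc m} (y ∷ v) x zero
  rewrite swapAll-map-suc (rotation m) zero = P.refl
lookup-∷ʳ-rotation {m = suc m} (y ∷ v) x (suc p)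
  rewrite swapAll-map-suc (rotation m) (suc p) with swapAll (rotation m) p | lookup-∷ʳ-rotation v x p
... | zero  | eq = eq
... | suc r | eq = eq

toList-tabulate-↑ : ∀ {a} {X : Set a} m n (f : Fin (m ℕ.+ n) → X) →
                    toList (tabulate f) ≡ toList (tabulate (f ∘ (_↑ˡ n))) ++ toList (tabulate (f ∘ (m ↑ʳ_)))
toList-tabulate-↑ zero    n f = P.refl
toList-tabulate-↑ (suc m) n f = P.cong (f zero ∷_) (toList-tabulate-↑ m n (f ∘ suc))

toList-tabulate-const : ∀ {a} {X : Set a} m (x : X) → toList (tabulate {n = m} (λ _ → x)) ≡ replicate m x
toList-tabulate-const zero    x = P.refl
toList-tabulate-const (suc m) x = P.cong (x ∷_) (toList-tabulate-const m x)

block-↑ˡ : ∀ {l} (d : Fin (suc l) → ℕ) (p : Fin (d zero)) → block d (p ↑ˡ total (d ∘ suc)) ≡ zero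
block-↑ˡ d p rewrite FP.splitAt-↑ˡ (d zero) p (total (d ∘ suc)) = P.refl

block-↑ʳ : ∀ {l} (d : Fin (suc l) → ℕ) (p : Fin (total (d ∘ suc))) → block d (d zero ↑ʳ p) ≡ suc (block (d ∘ suc) p)
block-↑ʳ d p rewrite FP.splitAt-↑ʳ (d zero) (total (d ∘ suc)) p = P.refl

module Determinant {c ℓ} (R : CommutativeRing c ℓ) where
  open CommutativeRing R hiding (zero)
  open IntegerCoefficientSolver R using (solve; _:+_; _:*_; :-_; _:-_; _:=_; con)
  open import Algebra.Properties.Ring ring using (-0#≈0#; -1*x≈-x; -‿distribˡ-*; -‿distribʳ-*)
  open import Algebra.Properties.AbelianGroup +-abelianGroup using (⁻¹-∙-comm)
  open import Algebra.Properties.CommutativeSemigroup +-commutativeSemigroup using (interchange)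
  open import Relation.Binary.Reasoning.Setoid setoid

  sumF-cong : ∀ {n} {f g : Fin n → Carrier} → (∀ i → f i ≈ g i) → sumF R f ≈ sumF R g
  sumF-cong {zero}  f≈g = refl
  sumF-cong {suc n} f≈g = +-cong (f≈g zero) (sumF-cong (f≈g ∘ suc))

  sumF-+ : ∀ {n} (f g : Fin n → Carrier) → sumF R (λ i → f i + g i) ≈ sumF R f + sumF R g
  sumF-+ {zero}  f g = sym (+-identityˡ 0#)
  sumF-+ {suc n} f g = trans (+-congˡ (sumF-+ (f ∘ suc) (g ∘ suc))) (interchange _ _ _ _)

  sumF-*ˡ : ∀ {n} a (f : Fin n → Carrier) → sumF R (λ i → a * f i) ≈ a * sumF R f
  sumF-*ˡ {zero}  a f = sym (zeroʳ a)
  sumF-*ˡ {suc n} a f = trans (+-congˡ (sumF-*ˡ a (f ∘ suc))) (sym (distribˡ _ _ _))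

  sumF-neg : ∀ {n} (f : Fin n → Carrier) → sumF R (λ i → - f i) ≈ - sumF R f
  sumF-neg {zero}  f = sym -0#≈0#
  sumF-neg {suc n} f = trans (+-congˡ (sumF-neg (f ∘ suc))) (⁻¹-∙-comm _ _)

  sumF-zero : ∀ {n} (f : Fin n → Carrier) → (∀ i → f i ≈ 0#) → sumF R f ≈ 0#
  sumF-zero {zero}  f f≈0 = refl
  sumF-zero {suc n} f f≈0 = trans (+-cong (f≈0 zero) (sumF-zero (f ∘ suc) (f≈0 ∘ suc))) (+-identityˡ 0#)

  sumF-linear : ∀ {n} {f g h : Fin n → Carrier} b a →
                (∀ i → f i ≈ b * g i + a * h i) → sumF R f ≈ b * sumF R g + a * sumF R h
  sumF-linear {f = f} {g} {h} b a f≈ = begin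
    sumF R f                                                ≈⟨ sumF-cong f≈ ⟩
    sumF R (λ i → b * g i + a * h i)                        ≈⟨ sumF-+ (λ i → b * g i) (λ i → a * h i) ⟩
    sumF R (λ i → b * g i) + sumF R (λ i → a * h i)         ≈⟨ +-cong (sumF-*ˡ b g) (sumF-*ˡ a h) ⟩
    b * sumF R g + a * sumF R h                             ∎

  x≈0⇒g*[x*d]≈0 : ∀ {g x d} → x ≈ 0# → g * (x * d) ≈ 0#
  x≈0⇒g*[x*d]≈0 x≈0 = trans (*-congˡ (trans (*-congʳ x≈0) (zeroˡ _))) (zeroʳ _)

  minor : ∀ {n} → Fin (suc n) → Matrix R (suc n) → Matrix R n
  minor j X p q = X (suc p) (punchIn j q)

  expansionTerm : ∀ {n} → Matrix R (suc n) → Fin (suc n) → Carrier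
  expansionTerm X j = sgn R j * (X zero j * det R (minor j X))

  det-cong : ∀ {n} {X Y : Matrix R n} → (∀ p q → X p q ≈ Y p q) → det R X ≈ det R Y
  det-cong {zero}  X≈Y = refl
  det-cong {suc n} X≈Y = sumF-cong λ j →
    *-congˡ {sgn R j} (*-cong (X≈Y zero j) (det-cong (λ p q → X≈Y (suc p) (punchIn j q))))

  det-row₀-linear : ∀ {n} (X Y Z : Matrix R (suc n)) b a →
                    (∀ q → X zero q ≈ b * Y zero q + a * Z zero q) →
                    (∀ p q → X (suc p) q ≈ Y (suc p) q) → (∀ p q → X (suc p) q ≈ Z (suc p) q) →
                    det R X ≈ b * det R Y + a * det R Z
  det-row₀-linear X Y Z b a row₀ X≈Y X≈Z = sumF-linear {f = expansionTerm X} b a term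
    where
    term : ∀ j → expansionTerm X j ≈ b * expansionTerm Y j + a * expansionTerm Z j
    term j = begin
      sgn R j * (X zero j * det R (minor j X))
        ≈⟨ *-congˡ (*-congʳ (row₀ j)) ⟩
      sgn R j * ((b * Y zero j + a * Z zero j) * det R (minor j X))
        ≈⟨ solve 6 (λ s b y a z d → s :* ((b :* y :+ a :* z) :* d) := b :* (s :* (y :* d)) :+ a :* (s :* (z :* d)))
                   refl (sgn R j) b (Y zero j) a (Z zero j) _ ⟩
      b * (sgn R j * (Y zero j * det R (minor j X))) + a * (sgn R j * (Z zero j * det R (minor j X)))
        ≈⟨ +-cong (*-congˡ (*-congˡ (*-congˡ (det-cong (λ p q → X≈Y p (punchIn j q))))))
                  (*-congˡ (*-congˡ (*-congˡ (det-cong (λ p q → X≈Z p (punchIn j q)))))) ⟩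
      b * expansionTerm Y j + a * expansionTerm Z j ∎

  det-row₁-linear : ∀ {n} (X Y Z : Matrix R (suc (suc n))) b a →
                    (∀ q → X zero q ≈ Y zero q) → (∀ q → X zero q ≈ Z zero q) →
                    (∀ q → X (suc zero) q ≈ b * Y (suc zero) q + a * Z (suc zero) q) →
                    (∀ p q → X (suc (suc p)) q ≈ Y (suc (suc p)) q) →
                    (∀ p q → X (suc (suc p)) q ≈ Z (suc (suc p)) q) →
                    det R X ≈ b * det R Y + a * det R Z
  det-row₁-linear X Y Z b a X₀≈Y₀ X₀≈Z₀ row₁ X≈Y X≈Z = sumF-linear {f = expansionTerm X} b a term
    where
    term : ∀ j → expansionTerm X j ≈ b * expansionTerm Y j + a * expansionTerm Z j
    term j = begin
      sgn R j * (X zero j * det R (minor j X))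
        ≈⟨ *-congˡ (*-congˡ (det-row₀-linear (minor j X) (minor j Y) (minor j Z) b a
              (λ q → row₁ (punchIn j q)) (λ p q → X≈Y p (punchIn j q)) (λ p q → X≈Z p (punchIn j q)))) ⟩
      sgn R j * (X zero j * (b * det R (minor j Y) + a * det R (minor j Z)))
        ≈⟨ solve 6 (λ s x b a d e → s :* (x :* (b :* d :+ a :* e)) := b :* (s :* (x :* d)) :+ a :* (s :* (x :* e)))
                   refl (sgn R j) (X zero j) b a _ _ ⟩
      b * (sgn R j * (X zero j * det R (minor j Y))) + a * (sgn R j * (X zero j * det R (minor j Z)))
        ≈⟨ +-cong (*-congˡ (*-congˡ (*-congʳ (X₀≈Y₀ j)))) (*-congˡ (*-congˡ (*-congʳ (X₀≈Z₀ j)))) ⟩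
      b * expansionTerm Y j + a * expansionTerm Z j ∎

  Extensional : ∀ {m n} → ((Fin m → Fin n) → Carrier) → Set _
  Extensional Φ = ∀ σ τ → (∀ q → σ q ≡ τ q) → Φ σ ≈ Φ τ

  -- det X unfolds to rowExpansion (X zero) Φ, where Φ σ is the determinant of the lower
  -- rows of X restricted to the columns σ.
  rowExpansion : ∀ {m} → (Fin (suc m) → Carrier) → ((Fin m → Fin (suc m)) → Carrier) → Carrier
  rowExpansion r Φ = sumF R λ k → sgn R k * (r k * Φ (punchIn k))

  twoRowExpansion : ∀ {m} (r s : Fin (suc (suc m)) → Carrier) →
                    ((Fin m → Fin (suc (suc m))) → Carrier) → Carrier
  twoRowExpansion r s Φ = rowExpansion r λ σ → rowExpansion (s ∘ σ) λ τ → Φ (σ ∘ τ)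

  rowExpansion-cong : ∀ {m} {r r′ : Fin (suc m) → Carrier} {Φ Ψ : (Fin m → Fin (suc m)) → Carrier} →
                      (∀ k → r k ≈ r′ k) → (∀ σ → Φ σ ≈ Ψ σ) → rowExpansion r Φ ≈ rowExpansion r′ Ψ
  rowExpansion-cong r≈r′ Φ≈Ψ = sumF-cong λ k → *-congˡ {sgn R k} (*-cong (r≈r′ k) (Φ≈Ψ (punchIn k)))

  rowExpansion-linear : ∀ {m} (r : Fin (suc m) → Carrier) a (Φ Ψ : (Fin m → Fin (suc m)) → Carrier) →
                        rowExpansion r (λ σ → a * Φ σ - Ψ σ) ≈ a * rowExpansion r Φ - rowExpansion r Ψ
  rowExpansion-linear r a Φ Ψ =
    trans (sumF-linear a (- 1#) λ k →
             solve 5 (λ s x a f g → s :* (x :* (a :* f :- g)) := a :* (s :* (x :* f)) :+ (:- con (+ 1)) :* (s :* (x :* g)))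
                   refl (sgn R k) (r k) a (Φ (punchIn k)) (Ψ (punchIn k)))
          (+-congˡ (-1*x≈-x _))

  rowExpansion-step : ∀ {m} (r : Fin (suc (suc m)) → Carrier) Φ → Extensional Φ →
                      rowExpansion r Φ ≈ r zero * Φ suc - rowExpansion (r ∘ suc) (λ σ → Φ (F.lift 1 σ))
  rowExpansion-step r Φ Φ-ext = +-cong (*-identityˡ _) (trans (sumF-cong {g = λ k → - term k} λ k →
    trans (*-congˡ { - sgn R k} (*-congˡ (Φ-ext _ _ (punchIn-suc k)))) (sym (-‿distribˡ-* _ _))) (sumF-neg term))
    where
    term : Fin _ → Carrier
    term k = sgn R k * (r (suc k) * Φ (F.lift 1 (punchIn k)))
    punchIn-suc : ∀ k q → punchIn (suc k) q ≡ F.lift 1 (punchIn k) q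
    punchIn-suc k zero    = P.refl
    punchIn-suc k (suc q) = P.refl

  twoRowExpansion-step : ∀ {m} (r s : Fin (suc (suc (suc m))) → Carrier) Φ → Extensional Φ →
                         twoRowExpansion r s Φ
                           ≈ r zero * rowExpansion (s ∘ suc) (λ σ → Φ (suc ∘ σ))
                             - (s zero * rowExpansion (r ∘ suc) (λ σ → Φ (suc ∘ σ))
                                - twoRowExpansion (r ∘ suc) (s ∘ suc) (λ σ → Φ (F.lift 1 σ)))
  twoRowExpansion-step {m} r s Φ Φ-ext = begin
    rowExpansion r Ψ
      ≈⟨ rowExpansion-step r Ψ Ψ-ext ⟩
    r zero * Ψ suc - rowExpansion (r ∘ suc) (λ σ → Ψ (F.lift 1 σ))
      ≈⟨ +-congˡ (-‿cong (rowExpansion-cong {r = r ∘ suc} {Φ = λ σ → Ψ (F.lift 1 σ)} (λ _ → refl) Ψ-lift)) ⟩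
    r zero * Ψ suc - rowExpansion (r ∘ suc) (λ σ → s zero * Φ (suc ∘ σ) - Ψ′ σ)
      ≈⟨ +-congˡ (-‿cong (rowExpansion-linear (r ∘ suc) (s zero) (λ σ → Φ (suc ∘ σ)) Ψ′)) ⟩
    r zero * Ψ suc - (s zero * rowExpansion (r ∘ suc) (λ σ → Φ (suc ∘ σ)) - rowExpansion (r ∘ suc) Ψ′) ∎
    where
    Ψ : (Fin (suc (suc m)) → Fin (suc (suc (suc m)))) → Carrier
    Ψ σ = rowExpansion (s ∘ σ) λ τ → Φ (σ ∘ τ)
    Ψ-ext : Extensional Ψ
    Ψ-ext σ τ σ≡τ = rowExpansion-cong {Φ = λ ρ → Φ (σ ∘ ρ)} {Ψ = λ ρ → Φ (τ ∘ ρ)}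
                      (λ k → reflexive (P.cong s (σ≡τ k))) λ ρ → Φ-ext _ _ λ q → σ≡τ (ρ q)
    Ψ′ : (Fin (suc m) → Fin (suc (suc m))) → Carrier
    Ψ′ σ = rowExpansion (s ∘ suc ∘ σ) λ τ → Φ (F.lift 1 (σ ∘ τ))
    Ψ-lift : ∀ σ → Ψ (F.lift 1 σ) ≈ s zero * Φ (suc ∘ σ) - Ψ′ σ
    Ψ-lift σ =
      trans (rowExpansion-step (s ∘ F.lift 1 σ) (λ τ → Φ (F.lift 1 σ ∘ τ))
                               λ τ τ′ τ≡τ′ → Φ-ext _ _ λ q → P.cong (F.lift 1 σ) (τ≡τ′ q))
            (+-congˡ (-‿cong (rowExpansion-cong {r = s ∘ suc ∘ σ}
                                                {Φ = λ τ → Φ (F.lift 1 σ ∘ F.lift 1 τ)} {Ψ = λ τ → Φ (F.lift 1 (σ ∘ τ))}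
                                                (λ _ → refl) λ τ → Φ-ext _ _ λ { zero → P.refl ; (suc q) → P.refl })))

  twoRowExpansion-equalRows : ∀ {m} (r s : Fin (suc (suc m)) → Carrier) Φ →
                              (∀ q → r q ≈ s q) → Extensional Φ → twoRowExpansion r s Φ ≈ 0#
  twoRowExpansion-equalRows {zero} r s Φ r≈s Φ-ext = begin
    1# * (r zero * (1# * (s (suc zero) * Φ σ₀) + 0#)) + ((- 1#) * (r (suc zero) * (1# * (s zero * Φ σ₁) + 0#)) + 0#)
      ≈⟨ +-congʳ (*-congˡ (*-cong (r≈s zero)
            (+-congʳ (*-congˡ (*-cong (sym (r≈s (suc zero))) (Φ-ext σ₀ σ₁ (λ ()))))))) ⟩
    1# * (s zero * (1# * (r (suc zero) * Φ σ₁) + 0#)) + ((- 1#) * (r (suc zero) * (1# * (s zero * Φ σ₁) + 0#)) + 0#)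
      ≈⟨ solve 3 (λ a b f → con (+ 1) :* (a :* (con (+ 1) :* (b :* f) :+ con (+ 0)))
                            :+ ((:- con (+ 1)) :* (b :* (con (+ 1) :* (a :* f) :+ con (+ 0))) :+ con (+ 0))
                            := con (+ 0))
                 refl (s zero) (r (suc zero)) (Φ σ₁) ⟩
    0# ∎
    where
    σ₀ σ₁ : Fin 0 → Fin 2
    σ₀ = punchIn zero ∘ punchIn zero
    σ₁ = punchIn (suc zero) ∘ punchIn zero
  twoRowExpansion-equalRows {suc m} r s Φ r≈s Φ-ext = begin
    twoRowExpansion r s Φ
      ≈⟨ twoRowExpansion-step r s Φ Φ-ext ⟩
    r zero * rowExpansion (s ∘ suc) Φ₊ - (s zero * T - twoRowExpansion (r ∘ suc) (s ∘ suc) (λ σ → Φ (F.lift 1 σ)))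
      ≈⟨ +-cong (*-cong (r≈s zero) (rowExpansion-cong {Φ = Φ₊} (λ k → sym (r≈s (suc k))) (λ _ → refl)))
                (-‿cong (+-congˡ (-‿cong (twoRowExpansion-equalRows (r ∘ suc) (s ∘ suc) _ (r≈s ∘ suc) Φ′-ext)))) ⟩
    s zero * T - (s zero * T - 0#)
      ≈⟨ solve 1 (λ x → x :- (x :- con (+ 0)) := con (+ 0)) refl (s zero * T) ⟩
    0# ∎
    where
    Φ₊ : (Fin (suc m) → Fin (suc (suc m))) → Carrier
    Φ₊ σ = Φ (suc ∘ σ)
    T = rowExpansion (r ∘ suc) Φ₊
    Φ′-ext : Extensional (λ σ → Φ (F.lift 1 σ))
    Φ′-ext σ τ σ≡τ = Φ-ext _ _ λ { zero → P.refl ; (suc q) → P.cong suc (σ≡τ q) }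

  det-equalRows₀₁ : ∀ {n} (X : Matrix R (suc (suc n))) → (∀ q → X zero q ≈ X (suc zero) q) → det R X ≈ 0#
  det-equalRows₀₁ X X₀≈X₁ =
    twoRowExpansion-equalRows (X zero) (X (suc zero)) (λ σ → det R (λ p q → X (suc (suc p)) (σ q))) X₀≈X₁
      λ σ τ σ≡τ → det-cong λ p q → reflexive (P.cong (X (suc (suc p))) (σ≡τ q))

  withRow₀ : ∀ {n} → (Fin (suc n) → Carrier) → Matrix R (suc n) → Matrix R (suc n)
  withRow₀ r X zero    = r
  withRow₀ r X (suc p) = X (suc p)

  withTopRows : ∀ {n} (r s : Fin (suc (suc n)) → Carrier) → Matrix R (suc (suc n)) → Matrix R (suc (suc n))
  withTopRows r s X zero          = r
  withTopRows r s X (suc zero)    = s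
  withTopRows r s X (suc (suc p)) = X (suc (suc p))

  det-withTopRows-antisym : ∀ {n} (r s : Fin (suc (suc n)) → Carrier) (X : Matrix R (suc (suc n))) →
                            det R (withTopRows r s X) + det R (withTopRows s r X) ≈ 0#
  det-withTopRows-antisym r s X = begin
    D r s + D s r
      ≈⟨ solve 4 (λ a b c d → a :+ b := (con (+ 1) :* (con (+ 1) :* c :+ con (+ 1) :* a)
                                         :+ con (+ 1) :* (con (+ 1) :* b :+ con (+ 1) :* d)) :+ :- c :+ :- d)
                 refl (D r s) (D s r) (D r r) (D s s) ⟩
    (1# * (1# * D r r + 1# * D r s) + 1# * (1# * D s r + 1# * D s s)) - D r r - D s s
      ≈⟨ +-cong (+-congʳ (sym expand-u)) (-‿cong (D-self s)) ⟩
    D u u - D r r - 0#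
      ≈⟨ +-congʳ (+-cong (D-self u) (-‿cong (D-self r))) ⟩
    0# - 0# - 0#
      ≈⟨ solve 0 (con (+ 0) :+ :- con (+ 0) :+ :- con (+ 0) := con (+ 0)) refl ⟩
    0# ∎
    where
    D : (Fin _ → Carrier) → (Fin _ → Carrier) → Carrier
    D r′ s′ = det R (withTopRows r′ s′ X)
    u : Fin _ → Carrier
    u q = r q + s q
    u≈r+s : ∀ q → u q ≈ 1# * r q + 1# * s q
    u≈r+s q = sym (+-cong (*-identityˡ _) (*-identityˡ _))
    D-self : ∀ v → D v v ≈ 0#
    D-self v = det-equalRows₀₁ (withTopRows v v X) (λ q → refl)
    expand-u : D u u ≈ 1# * (1# * D r r + 1# * D r s) + 1# * (1# * D s r + 1# * D s s)
    expand-u = trans (det-row₀-linear (W u u) (W r u) (W s u) 1# 1# u≈r+s (lower {u} {r}) (lower {u} {s}))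
                     (+-cong (*-congˡ (split r)) (*-congˡ (split s)))
      where
      W = λ r′ s′ → withTopRows r′ s′ X
      lower : ∀ {r′ r″ s′} p q → W r′ s′ (suc p) q ≈ W r″ s′ (suc p) q
      lower zero    q = refl
      lower (suc p) q = refl
      split : ∀ v → D v u ≈ 1# * D v r + 1# * D v s
      split v = det-row₁-linear (W v u) (W v r) (W v s) 1# 1# (λ _ → refl) (λ _ → refl) u≈r+s
                                (λ _ _ → refl) (λ _ _ → refl)

  RowPermutationScales : ∀ {n} → (Fin n → Fin n) → Carrier → Set _
  RowPermutationScales σ k = ∀ X → det R (λ p q → X (σ p) q) ≈ k * det R X

  ColumnPermutationScales : ∀ {n} → (Fin n → Fin n) → Carrier → Set _
  ColumnPermutationScales σ k = ∀ X → det R (λ p q → X p (σ q)) ≈ k * det R X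

  RowPermutationScales-∘ : ∀ {n} {σ τ : Fin n → Fin n} {a b} →
    RowPermutationScales σ a → RowPermutationScales τ b → RowPermutationScales (σ ∘ τ) (a * b)
  RowPermutationScales-∘ {σ = σ} {a = a} {b} σ-scales τ-scales X = begin
    det R (λ p q → X (σ _) q)      ≈⟨ τ-scales (λ p q → X (σ p) q) ⟩
    b * det R (λ p q → X (σ p) q)  ≈⟨ *-congˡ (σ-scales X) ⟩
    b * (a * det R X)              ≈⟨ solve 3 (λ a b d → b :* (a :* d) := (a :* b) :* d) refl a b (det R X) ⟩
    (a * b) * det R X              ∎

  ColumnPermutationScales-∘ : ∀ {n} {σ τ : Fin n → Fin n} {a b} →
    ColumnPermutationScales σ a → ColumnPermutationScales τ b → ColumnPermutationScales (σ ∘ τ) (a * b)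
  ColumnPermutationScales-∘ {σ = σ} {a = a} {b} σ-scales τ-scales X = begin
    det R (λ p q → X p (σ _))      ≈⟨ τ-scales (λ p q → X p (σ q)) ⟩
    b * det R (λ p q → X p (σ q))  ≈⟨ *-congˡ (σ-scales X) ⟩
    b * (a * det R X)              ≈⟨ solve 3 (λ a b d → b :* (a :* d) := (a :* b) :* d) refl a b (det R X) ⟩
    (a * b) * det R X              ∎

  RowPermutationScales-lift : ∀ {n} {σ : Fin n → Fin n} {k} →
    RowPermutationScales σ k → RowPermutationScales (F.lift 1 σ) k
  RowPermutationScales-lift {k = k} σ-scales X =
    trans (sumF-cong {g = λ j → k * expansionTerm X j} λ j →
            trans (*-congˡ (*-congˡ (σ-scales (minor j X))))
                  (solve 4 (λ s x k d → s :* (x :* (k :* d)) := k :* (s :* (x :* d)))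
                         refl (sgn R j) (X zero j) k (det R (minor j X))))
          (sumF-*ˡ k (expansionTerm X))

  det-swapAt₀-rows : ∀ {n} → RowPermutationScales (swapAt {suc n} zero) (- 1#)
  det-swapAt₀-rows X = begin
    det R (λ p q → X (swapAt zero p) q)   ≈⟨ det-cong swapped≈ ⟩
    D (X (suc zero)) (X zero)
      ≈⟨ solve 2 (λ a b → b := (a :+ b) :+ (:- con (+ 1)) :* a) refl (D (X zero) (X (suc zero))) _ ⟩
    (D (X zero) (X (suc zero)) + D (X (suc zero)) (X zero)) + - 1# * D (X zero) (X (suc zero))
      ≈⟨ +-cong (det-withTopRows-antisym (X zero) (X (suc zero)) X)
                (*-congˡ (det-cong unswapped≈)) ⟩
    0# + - 1# * det R X                   ≈⟨ +-identityˡ _ ⟩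
    - 1# * det R X                        ∎
    where
    D : (Fin _ → Carrier) → (Fin _ → Carrier) → Carrier
    D r s = det R (withTopRows r s X)
    swapped≈ : ∀ p q → X (swapAt zero p) q ≈ withTopRows (X (suc zero)) (X zero) X p q
    swapped≈ zero          q = refl
    swapped≈ (suc zero)    q = refl
    swapped≈ (suc (suc p)) q = refl
    unswapped≈ : ∀ p q → withTopRows (X zero) (X (suc zero)) X p q ≈ X p q
    unswapped≈ zero          q = refl
    unswapped≈ (suc zero)    q = refl
    unswapped≈ (suc (suc p)) q = refl

  det-swapAt-rows : ∀ {n} (i : Fin n) → RowPermutationScales (swapAt i) (- 1#)
  det-swapAt-rows {suc n} zero    = det-swapAt₀-rows
  det-swapAt-rows {suc n} (suc i) = RowPermutationScales-lift {σ = swapAt i} (det-swapAt-rows i)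

  Alternating : ∀ {m n} → ((Fin (suc m) → Fin n) → Carrier) → Set _
  Alternating {m} Φ = ∀ (j : Fin m) σ → Φ (σ ∘ swapAt j) ≈ - Φ σ

  rowExpansion-swapAt : ∀ {m} (i : Fin (suc m)) r (Φ : (Fin (suc m) → Fin (suc (suc m))) → Carrier) →
                        Extensional Φ → Alternating Φ →
                        rowExpansion (r ∘ swapAt i) (λ σ → Φ (swapAt i ∘ σ)) ≈ - rowExpansion r Φ
  rowExpansion-swapAt {m} zero r Φ Φ-ext Φ-alt = begin
    1# * (r (suc zero) * Φ (swapAt zero ∘ suc)) + (- 1# * (r zero * Φ (swapAt zero ∘ punchIn (suc zero))) + sumF R swappedTerm)
      ≈⟨ +-cong (*-congˡ (*-congˡ (Φ-ext _ _ λ { zero → P.refl ; (suc q) → P.refl })))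
                (+-cong (*-congˡ (*-congˡ (Φ-ext _ _ λ { zero → P.refl ; (suc q) → P.refl })))
                        (trans (sumF-cong {g = λ k → - term k} swappedTerm≈) (sumF-neg term))) ⟩
    1# * (r (suc zero) * Φ (punchIn (suc zero))) + (- 1# * (r zero * Φ (punchIn zero)) + - sumF R term)
      ≈⟨ solve 5 (λ a b c d s → con (+ 1) :* (a :* b) :+ ((:- con (+ 1)) :* (c :* d) :+ :- s)
                                := :- (con (+ 1) :* (c :* d) :+ ((:- con (+ 1)) :* (a :* b) :+ s)))
                 refl _ _ _ _ (sumF R term) ⟩
    - (1# * (r zero * Φ (punchIn zero)) + (- 1# * (r (suc zero) * Φ (punchIn (suc zero))) + sumF R term)) ∎
    where
    term swappedTerm : Fin m → Carrier
    term k        = sgn R (suc (suc k)) * (r (suc (suc k)) * Φ (punchIn (suc (suc k))))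
    swappedTerm k = sgn R (suc (suc k)) * (r (suc (suc k)) * Φ (swapAt zero ∘ punchIn (suc (suc k))))
    commutes : ∀ {m} (k : Fin (suc m)) q → swapAt zero (punchIn (suc (suc k)) q) ≡ punchIn (suc (suc k)) (swapAt zero q)
    commutes zero    zero          = P.refl
    commutes zero    (suc zero)    = P.refl
    commutes zero    (suc (suc q)) = P.refl
    commutes (suc k) zero          = P.refl
    commutes (suc k) (suc zero)    = P.refl
    commutes (suc k) (suc (suc q)) = P.refl
    negate : ∀ {x y : Carrier} g → x ≈ - y → g * x ≈ - (g * y)
    negate {y = y} g x≈-y = trans (*-congˡ x≈-y) (sym (-‿distribʳ-* g y))
    swappedTerm≈ : ∀ k → swappedTerm k ≈ - term k
    swappedTerm≈ k@zero    = negate _ (negate _ (trans (Φ-ext _ _ (commutes k)) (Φ-alt zero (punchIn (suc (suc k))))))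
    swappedTerm≈ k@(suc _) = negate _ (negate _ (trans (Φ-ext _ _ (commutes k)) (Φ-alt zero (punchIn (suc (suc k))))))
  rowExpansion-swapAt {suc m} (suc i) r Φ Φ-ext Φ-alt = begin
    rowExpansion (r ∘ swapAt (suc i)) Φₛ
      ≈⟨ rowExpansion-step (r ∘ swapAt (suc i)) Φₛ Φₛ-ext ⟩
    r zero * Φ (suc ∘ swapAt i) - rowExpansion (r′ ∘ swapAt i) (λ σ → Φₛ (F.lift 1 σ))
      ≈⟨ +-cong (*-congˡ (Φ-alt i suc))
                (-‿cong (trans (rowExpansion-cong {r = r′ ∘ swapAt i} {Φ = λ σ → Φₛ (F.lift 1 σ)} (λ _ → refl)
                                  λ σ → Φ-ext _ (F.lift 1 (swapAt i ∘ σ)) λ { zero → P.refl ; (suc q) → P.refl })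
                               (rowExpansion-swapAt i r′ Φ′ Φ′-ext Φ′-alt))) ⟩
    r zero * - Φ suc - - rowExpansion r′ Φ′
      ≈⟨ solve 3 (λ a f t → a :* (:- f) :- (:- t) := :- (a :* f :- t)) refl (r zero) (Φ suc) (rowExpansion r′ Φ′) ⟩
    - (r zero * Φ suc - rowExpansion r′ Φ′)
      ≈⟨ -‿cong (rowExpansion-step r Φ Φ-ext) ⟨
    - rowExpansion r Φ ∎
    where
    Φₛ : (Fin (suc (suc m)) → Fin (suc (suc (suc m)))) → Carrier
    Φₛ σ = Φ (swapAt (suc i) ∘ σ)
    Φₛ-ext : Extensional Φₛ
    Φₛ-ext σ τ σ≡τ = Φ-ext _ _ λ q → P.cong (swapAt (suc i)) (σ≡τ q)
    r′ : Fin (suc (suc m)) → Carrier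
    r′ = r ∘ suc
    Φ′ : (Fin (suc m) → Fin (suc (suc m))) → Carrier
    Φ′ σ = Φ (F.lift 1 σ)
    Φ′-ext : Extensional Φ′
    Φ′-ext σ τ σ≡τ = Φ-ext _ _ λ { zero → P.refl ; (suc q) → P.cong suc (σ≡τ q) }
    Φ′-alt : Alternating Φ′
    Φ′-alt j σ = trans (Φ-ext (F.lift 1 (σ ∘ swapAt j)) (F.lift 1 σ ∘ swapAt (suc j))
                              λ { zero → P.refl ; (suc q) → P.refl })
                       (Φ-alt (suc j) (F.lift 1 σ))

  det-swapAt-columns : ∀ {n} (i : Fin n) → ColumnPermutationScales (swapAt i) (- 1#)
  det-swapAt-columns {suc m} i X = trans (rowExpansion-swapAt i (X zero) Φ Φ-ext Φ-alt) (sym (-1*x≈-x _))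
    where
    Φ : (Fin (suc m) → Fin (suc (suc m))) → Carrier
    Φ σ = det R (λ p q → X (suc p) (σ q))
    Φ-ext : Extensional Φ
    Φ-ext σ τ σ≡τ = det-cong (λ p q → reflexive (P.cong (X (suc p)) (σ≡τ q)))
    Φ-alt : Alternating Φ
    Φ-alt j σ = trans (det-swapAt-columns j (λ p q → X (suc p) (σ q))) (-1*x≈-x _)

  det-swapAll-rows : ∀ {m} (is : List (Fin m)) → RowPermutationScales (swapAll is) (pow R (- 1#) (length is))
  det-swapAll-rows []       X = sym (*-identityˡ _)
  det-swapAll-rows (i ∷ is) =
    RowPermutationScales-∘ {σ = swapAt i} {τ = swapAll is} (det-swapAt-rows i) (det-swapAll-rows is)

  det-swapAll-columns : ∀ {m} (is : List (Fin m)) → ColumnPermutationScales (swapAll is) (pow R (- 1#) (length is))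
  det-swapAll-columns []       X = sym (*-identityˡ _)
  det-swapAll-columns (i ∷ is) =
    ColumnPermutationScales-∘ {σ = swapAt i} {τ = swapAll is} (det-swapAt-columns i) (det-swapAll-columns is)

  pow-neg1-square : ∀ k → pow R (- 1#) k * pow R (- 1#) k ≈ 1#
  pow-neg1-square zero    = *-identityˡ 1#
  pow-neg1-square (suc k) = trans (solve 1 (λ x → (:- con (+ 1) :* x) :* (:- con (+ 1) :* x) := x :* x) refl _)
                                  (pow-neg1-square k)

  det-conjugate-swapAll : ∀ {m} (is : List (Fin m)) X →
                          det R (λ p q → X (swapAll is p) (swapAll is q)) ≈ det R X
  det-conjugate-swapAll is X = begin
    det R (λ p q → X (swapAll is p) (swapAll is q))  ≈⟨ det-swapAll-rows is (λ p q → X p (swapAll is q)) ⟩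
    s * det R (λ p q → X p (swapAll is q))          ≈⟨ *-congˡ (det-swapAll-columns is X) ⟩
    s * (s * det R X)                               ≈⟨ *-assoc s s _ ⟨
    (s * s) * det R X                               ≈⟨ *-congʳ (pow-neg1-square (length is)) ⟩
    1# * det R X                                    ≈⟨ *-identityˡ _ ⟩
    det R X                                         ∎
    where
    s = pow R (- 1#) (length is)

  det-row₀-unit₀ : ∀ {n} (X : Matrix R (suc n)) → (∀ q → X zero (suc q) ≈ 0#) →
                   det R X ≈ X zero zero * det R (minor zero X)
  det-row₀-unit₀ X row₀ = trans (+-cong (*-identityˡ _) (sumF-zero _ λ j → x≈0⇒g*[x*d]≈0 (row₀ j))) (+-identityʳ _)

  det-row₀-unit₁ : ∀ {n} (X : Matrix R (suc (suc n))) → X zero zero ≈ 0# → (∀ q → X zero (suc (suc q)) ≈ 0#) →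
                   det R X ≈ - (X zero (suc zero) * det R (minor (suc zero) X))
  det-row₀-unit₁ X X₀₀≈0 row₀ =
    trans (+-cong (x≈0⇒g*[x*d]≈0 X₀₀≈0) (+-congˡ (sumF-zero _ λ j → x≈0⇒g*[x*d]≈0 (row₀ j))))
          (solve 2 (λ a d → con (+ 0) :+ ((:- con (+ 1)) :* (a :* d) :+ con (+ 0)) := :- (a :* d)) refl _ _)

module LabelledRows {c ℓ} (R : CommutativeRing c ℓ) {L : ℕ} (A : Matrix R L) (λ' : Fin L → CommutativeRing.Carrier R) where
  open CommutativeRing R hiding (zero)
  open IntegerCoefficientSolver R using (solve; _:+_; _:*_; :-_; _:=_; con)
  open Determinant R
  open import Relation.Binary.Reasoning.Setoid setoid

  δ-suc : ∀ {n} (p q : Fin n) x → δ R (suc p) (suc q) x ≡ δ R p q x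
  δ-suc p q x with p ≟ q
  ... | yes _ = P.refl
  ... | no  _ = P.refl

  δ-injective : ∀ {n} (σ : Fin n → Fin n) → (∀ {p q} → σ p ≡ σ q → p ≡ q) →
                ∀ p q x → δ R (σ p) (σ q) x ≡ δ R p q x
  δ-injective σ σ-inj p q x with σ p ≟ σ q | p ≟ q
  ... | yes _   | yes _   = P.refl
  ... | no  _   | no  _   = P.refl
  ... | yes σp≡σq | no p≢q  = ⊥-elim (p≢q (σ-inj σp≡σq))
  ... | no σp≢σq  | yes p≡q = ⊥-elim (σp≢σq (P.cong σ p≡q))

  -- A row (i , w) of M(A,λ,d) or M̄(A,λ,d) is labelled by its block i and weighted by 1 or
  -- by d_i, respectively.
  Row : Set c
  Row = Fin L × Carrier

  label : ∀ {n} → Vec Row n → Fin n → Fin L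
  label v p = proj₁ (lookup v p)

  rowMatrix : ∀ {n} → Vec Row n → Matrix R n
  rowMatrix v p q = proj₂ (lookup v p) * A (label v p) (label v q) + δ R p q (λ' (label v p))

  det-rowMatrix-rotate : ∀ {m} x (v : Vec Row m) → det R (rowMatrix (x ∷ v)) ≈ det R (rowMatrix (v ∷ʳ x))
  det-rowMatrix-rotate {m} x v =
    sym (trans (det-cong rotated≈) (det-conjugate-swapAll (rotation m) (rowMatrix (x ∷ v))))
    where
    σ = swapAll (rotation m)
    rotated≈ : ∀ p q → rowMatrix (v ∷ʳ x) p q ≈ rowMatrix (x ∷ v) (σ p) (σ q)
    rotated≈ p q rewrite lookup-∷ʳ-rotation v x p | lookup-∷ʳ-rotation v x q
                       | δ-injective σ (swapAll-injective (rotation m)) p q (λ' (label (x ∷ v) (σ p))) = refl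

  unit₀ : ∀ {n} → Fin (suc n) → Carrier
  unit₀ zero    = 1#
  unit₀ (suc _) = 0#

  unit₁ : ∀ {n} → Fin (suc (suc n)) → Carrier
  unit₁ zero          = 0#
  unit₁ (suc zero)    = 1#
  unit₁ (suc (suc _)) = 0#

  -- The weight 0# is irrelevant: the first row is replaced.
  headMatrix : ∀ {n} → Fin L → Vec Row n → Matrix R (suc n)
  headMatrix i v = withRow₀ (λ q → A i (label ((i , 0#) ∷ v) q)) (rowMatrix ((i , 0#) ∷ v))

  det-rowMatrix-∷ : ∀ {n} i w (v : Vec Row n) →
                    det R (rowMatrix ((i , w) ∷ v)) ≈ w * det R (headMatrix i v) + λ' i * det R (rowMatrix v)
  det-rowMatrix-∷ i w v =
    trans (det-row₀-linear X (headMatrix i v) (withRow₀ unit₀ X) w (λ' i) row₀ lower (λ _ _ → refl))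
          (+-congˡ (*-congˡ deleted))
    where
    X = rowMatrix ((i , w) ∷ v)
    row₀ : ∀ q → X zero q ≈ w * A i (label ((i , 0#) ∷ v) q) + λ' i * unit₀ q
    row₀ zero    = +-congˡ (sym (*-identityʳ _))
    row₀ (suc q) = +-congˡ (sym (zeroʳ _))
    lower : ∀ p q → X (suc p) q ≈ headMatrix i v (suc p) q
    lower p zero    = refl
    lower p (suc q) = refl
    deleted : det R (withRow₀ unit₀ X) ≈ det R (rowMatrix v)
    deleted = begin
      det R (withRow₀ unit₀ X)                  ≈⟨ det-row₀-unit₀ (withRow₀ unit₀ X) (λ _ → refl) ⟩
      1# * det R (minor zero (withRow₀ unit₀ X)) ≈⟨ *-identityˡ _ ⟩
      det R (minor zero (withRow₀ unit₀ X))      ≈⟨ det-cong (λ p q → +-congˡ (reflexive (δ-suc p q (λ' (label v p))))) ⟩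
      det R (rowMatrix v)                        ∎

  det-headMatrix-unit₁ : ∀ {n} i b (v : Vec Row n) →
                         let H = headMatrix i ((i , b) ∷ v) in
                         det R (withTopRows (H zero) unit₁ H) ≈ det R (headMatrix i v)
  det-headMatrix-unit₁ i b v = begin
    det R (withTopRows x unit₁ H)              ≈⟨ det-cong swapped ⟩
    det R (λ p q → M (swapAt zero p) q)        ≈⟨ det-swapAt₀-rows M ⟩
    - 1# * det R M                             ≈⟨ *-congˡ (det-row₀-unit₁ M refl (λ _ → refl)) ⟩
    - 1# * - (1# * det R (minor (suc zero) M)) ≈⟨ solve 1 (λ d → :- con (+ 1) :* (:- (con (+ 1) :* d)) := d) refl _ ⟩
    det R (minor (suc zero) M)                 ≈⟨ det-cong minor≈head ⟩
    det R (headMatrix i v)                     ∎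
    where
    H = headMatrix i ((i , b) ∷ v)
    x = H zero
    M = withTopRows unit₁ x H
    swapped : ∀ p q → withTopRows x unit₁ H p q ≈ M (swapAt zero p) q
    swapped zero          q = refl
    swapped (suc zero)    q = refl
    swapped (suc (suc p)) q = refl
    minor≈head : ∀ p q → minor (suc zero) M p q ≈ headMatrix i v p q
    minor≈head zero    zero    = refl
    minor≈head zero    (suc q) = refl
    minor≈head (suc p) zero    = refl
    minor≈head (suc p) (suc q) = +-congˡ (reflexive (δ-suc (suc p) (suc q) (λ' (label v p))))

  det-rowMatrix-merge : ∀ {n} i a b (v : Vec Row n) →
                        det R (rowMatrix ((i , a) ∷ (i , b) ∷ v)) ≈ λ' i * det R (rowMatrix ((i , a + b) ∷ v))
  det-rowMatrix-merge i a b v = begin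
    det R (rowMatrix ((i , a) ∷ (i , b) ∷ v))
      ≈⟨ det-rowMatrix-∷ i a ((i , b) ∷ v) ⟩
    a * det R H + λ' i * det R (rowMatrix ((i , b) ∷ v))
      ≈⟨ +-cong (*-congˡ H-expansion) (*-congˡ (det-rowMatrix-∷ i b v)) ⟩
    a * (b * det R (withTopRows x x H) + λ' i * det R (withTopRows x unit₁ H)) + λ' i * (b * Y + λ' i * F)
      ≈⟨ +-congʳ (*-congˡ (+-cong (*-congˡ (det-equalRows₀₁ (withTopRows x x H) (λ _ → refl)))
                                  (*-congˡ (det-headMatrix-unit₁ i b v)))) ⟩
    a * (b * 0# + λ' i * Y) + λ' i * (b * Y + λ' i * F)
      ≈⟨ solve 5 (λ a b l y f → a :* (b :* con (+ 0) :+ l :* y) :+ l :* (b :* y :+ l :* f)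
                              := l :* ((a :+ b) :* y :+ l :* f))
                 refl a b (λ' i) Y F ⟩
    λ' i * ((a + b) * Y + λ' i * F)
      ≈⟨ *-congˡ (det-rowMatrix-∷ i (a + b) v) ⟨
    λ' i * det R (rowMatrix ((i , a + b) ∷ v)) ∎
    where
    H = headMatrix i ((i , b) ∷ v)
    x = H zero
    Y = det R (headMatrix i v)
    F = det R (rowMatrix v)
    row₁ : ∀ q → H (suc zero) q ≈ b * x q + λ' i * unit₁ q
    row₁ zero          = +-congˡ (sym (zeroʳ _))
    row₁ (suc zero)    = +-congˡ (sym (*-identityʳ _))
    row₁ (suc (suc q)) = +-congˡ (sym (zeroʳ _))
    H-expansion : det R H ≈ b * det R (withTopRows x x H) + λ' i * det R (withTopRows x unit₁ H)
    H-expansion = det-row₁-linear H (withTopRows x x H) (withTopRows x unit₁ H) b (λ' i)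
                    (λ _ → refl) (λ _ → refl) row₁ (λ _ _ → refl) (λ _ _ → refl)

  det-rowMatrix-cast : ∀ {m n} (m≡n : m ≡ n) (v : Vec Row m) →
                       det R (rowMatrix (V.cast m≡n v)) ≈ det R (rowMatrix v)
  det-rowMatrix-cast P.refl v = reflexive (P.cong (det R ∘ rowMatrix) (VP.cast-is-id P.refl v))

  det-rowMatrix-toList : ∀ {m n} (v : Vec Row m) (w : Vec Row n) → toList v ≡ toList w →
                         det R (rowMatrix v) ≈ det R (rowMatrix w)
  det-rowMatrix-toList v w v≡w =
    trans (sym (det-rowMatrix-cast m≡n v)) (reflexive (P.cong (det R ∘ rowMatrix) (VP.toList-injective m≡n v w v≡w)))
    where
    m≡n = P.trans (P.sym (VP.length-toList v)) (P.trans (P.cong L.length v≡w) (VP.length-toList w))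

  -- Lists avoid the length arithmetic of appending vectors; det-rowMatrix-toList transports
  -- back to vectors.
  detRows : List Row → Carrier
  detRows v = det R (rowMatrix (fromList v))

  detRows-rotate : ∀ x v → detRows (x ∷ v) ≈ detRows (v ++ [ x ])
  detRows-rotate x v = trans (det-rowMatrix-rotate x (fromList v)) (det-rowMatrix-toList (fromList v ∷ʳ x) (fromList (v ++ [ x ])) same)
    where
    same : toList (fromList v ∷ʳ x) ≡ toList (fromList (v ++ [ x ]))
    same = P.trans (VP.toList-∷ʳ x (fromList v))
                   (P.trans (P.cong (_++ [ x ]) (VP.toList∘fromList v)) (P.sym (VP.toList∘fromList (v ++ [ x ]))))

  detRows-weight-cong : ∀ i {a a′} v → a ≈ a′ → detRows ((i , a) ∷ v) ≈ detRows ((i , a′) ∷ v)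
  detRows-weight-cong i {a} {a′} v a≈a′ =
    det-cong {X = rowMatrix (fromList ((i , a) ∷ v))} {Y = rowMatrix (fromList ((i , a′) ∷ v))} λ
      { zero    zero    → +-congʳ (*-congʳ a≈a′)
      ; zero    (suc q) → +-congʳ (*-congʳ a≈a′)
      ; (suc p) zero    → refl
      ; (suc p) (suc q) → refl
      }

  detRows-mergeBlock : ∀ k i a v →
                       detRows ((i , a) ∷ replicate k (i , 1#) ++ v) ≈ pow R (λ' i) k * detRows ((i , a + fromℕ R k) ∷ v)
  detRows-mergeBlock zero    i a v = trans (detRows-weight-cong i v (sym (+-identityʳ a))) (sym (*-identityˡ _))
  detRows-mergeBlock (suc k) i a v = begin
    detRows ((i , a) ∷ (i , 1#) ∷ replicate k (i , 1#) ++ v)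
      ≈⟨ det-rowMatrix-merge i a 1# (fromList (replicate k (i , 1#) ++ v)) ⟩
    λ' i * detRows ((i , a + 1#) ∷ replicate k (i , 1#) ++ v)
      ≈⟨ *-congˡ (detRows-mergeBlock k i (a + 1#) v) ⟩
    λ' i * (pow R (λ' i) k * detRows ((i , (a + 1#) + fromℕ R k) ∷ v))
      ≈⟨ *-assoc _ _ _ ⟨
    pow R (λ' i) (suc k) * detRows ((i , (a + 1#) + fromℕ R k) ∷ v)
      ≈⟨ *-congˡ (detRows-weight-cong i v (+-assoc a 1# (fromℕ R k))) ⟩
    pow R (λ' i) (suc k) * detRows ((i , a + fromℕ R (suc k)) ∷ v) ∎

  -- k i is the block size minus one.
  blockRows : ∀ {l} → (Fin l → Fin L) → (Fin l → ℕ) → List Row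
  blockRows {zero}  g k = []
  blockRows {suc l} g k = replicate (suc (k zero)) (g zero , 1#) ++ blockRows (g ∘ suc) (k ∘ suc)

  mergedRows : ∀ {l} → (Fin l → Fin L) → (Fin l → ℕ) → List Row
  mergedRows {zero}  g k = []
  mergedRows {suc l} g k = (g zero , fromℕ R (suc (k zero))) ∷ mergedRows (g ∘ suc) (k ∘ suc)

  detRows-blocks : ∀ {l} (g : Fin l → Fin L) (k : Fin l → ℕ) done →
                   detRows (blockRows g k ++ done) ≈ prodF R (λ i → pow R (λ' (g i)) (k i)) * detRows (done ++ mergedRows g k)
  detRows-blocks {zero}  g k done = sym (trans (*-identityˡ _) (reflexive (P.cong detRows (LP.++-identityʳ done))))
  detRows-blocks {suc l} g k done = begin
    detRows (blockRows g k ++ done)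
      ≡⟨ P.cong (λ rows → detRows ((g zero , 1#) ∷ rows)) (LP.++-assoc (replicate (k zero) (g zero , 1#)) rest done) ⟩
    detRows ((g zero , 1#) ∷ replicate (k zero) (g zero , 1#) ++ rest ++ done)
      ≈⟨ detRows-mergeBlock (k zero) (g zero) 1# (rest ++ done) ⟩
    λᵏ * detRows (merged ∷ rest ++ done)
      ≈⟨ *-congˡ (detRows-rotate merged (rest ++ done)) ⟩
    λᵏ * detRows ((rest ++ done) ++ [ merged ])
      ≡⟨ P.cong (λ rows → λᵏ * detRows rows) (LP.++-assoc rest done [ merged ]) ⟩
    λᵏ * detRows (rest ++ done ++ [ merged ])
      ≈⟨ *-congˡ (detRows-blocks (g ∘ suc) (k ∘ suc) (done ++ [ merged ])) ⟩
    λᵏ * (Π′ * detRows ((done ++ [ merged ]) ++ mergedRows (g ∘ suc) (k ∘ suc)))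
      ≡⟨ P.cong (λ rows → λᵏ * (Π′ * detRows rows)) (LP.++-assoc done [ merged ] (mergedRows (g ∘ suc) (k ∘ suc))) ⟩
    λᵏ * (Π′ * detRows (done ++ mergedRows g k))
      ≈⟨ *-assoc _ _ _ ⟨
    (λᵏ * Π′) * detRows (done ++ mergedRows g k) ∎
    where
    rest = blockRows (g ∘ suc) (k ∘ suc)
    merged = (g zero , fromℕ R (suc (k zero)))
    λᵏ = pow R (λ' (g zero)) (k zero)
    Π′ = prodF R (λ i → pow R (λ' (g (suc i))) (k (suc i)))

module _ {c ℓ} (R : CommutativeRing c ℓ) {L : ℕ} (A : Matrix R L) (λ' : Fin L → CommutativeRing.Carrier R) where
  open CommutativeRing R hiding (zero)
  open LabelledRows R A λ'
  open Determinant R using (det-cong)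

  blockRows-tabulate : ∀ {l} (g : Fin l → Fin L) (d : Fin l → ℕ) → (∀ i → 1 ≤ d i) →
                       toList (tabulate (λ p → (g (block d p) , 1#))) ≡ blockRows g (λ i → d i ∸ 1)
  blockRows-tabulate {zero}  g d d≥1 = P.refl
  blockRows-tabulate {suc l} g d d≥1 = begin
    toList (tabulate (λ p → (g (block d p) , 1#)))
      ≡⟨ toList-tabulate-↑ (d zero) (total (d ∘ suc)) _ ⟩
    toList (tabulate (λ p → (g (block d (p ↑ˡ _)) , 1#))) ++ toList (tabulate (λ p → (g (block d (d zero ↑ʳ p)) , 1#)))
      ≡⟨ P.cong₂ _++_ first rest ⟩
    replicate (d zero) (g zero , 1#) ++ blockRows (g ∘ suc) (λ i → d (suc i) ∸ 1)
      ≡⟨ P.cong (λ m → replicate m (g zero , 1#) ++ blockRows (g ∘ suc) (λ i → d (suc i) ∸ 1))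
                (ℕP.m+[n∸m]≡n (d≥1 zero)) ⟨
    blockRows g (λ i → d i ∸ 1) ∎
    where
    open P.≡-Reasoning
    first = P.trans (P.cong toList (VP.tabulate-cong (λ p → P.cong (λ b → (g b , 1#)) (block-↑ˡ d p))))
                    (toList-tabulate-const (d zero) _)
    rest = P.trans (P.cong toList (VP.tabulate-cong (λ p → P.cong (λ b → (g b , 1#)) (block-↑ʳ d p))))
                   (blockRows-tabulate (g ∘ suc) (d ∘ suc) (d≥1 ∘ suc))

  mergedRows-tabulate : ∀ {l} (g : Fin l → Fin L) (d : Fin l → ℕ) → (∀ i → 1 ≤ d i) →
                        toList (tabulate (λ i → (g i , fromℕ R (d i)))) ≡ mergedRows g (λ i → d i ∸ 1)
  mergedRows-tabulate {zero}  g d d≥1 = P.refl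
  mergedRows-tabulate {suc l} g d d≥1 =
    P.cong₂ _∷_ (P.cong (λ m → (g zero , fromℕ R m)) (P.sym (ℕP.m+[n∸m]≡n (d≥1 zero))))
                (mergedRows-tabulate (g ∘ suc) (d ∘ suc) (d≥1 ∘ suc))

  det-bigM : (d : Fin L → ℕ) → (∀ i → 1 ≤ d i) →
             det R (bigM R A λ' d) ≈ det R (barM R A λ' d) * prodF R (λ i → pow R (λ' i) (d i ∸ 1))
  det-bigM d d≥1 = begin
    det R (bigM R A λ' d)                    ≈⟨ det-cong bigM≈ ⟩
    det R (rowMatrix (tabulate blockRow))    ≈⟨ det-rowMatrix-toList (tabulate blockRow) (fromList (blockRows id k ++ [])) blocks ⟩
    detRows (blockRows id k ++ [])           ≈⟨ detRows-blocks id k [] ⟩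
    Π * detRows (mergedRows id k)            ≈⟨ *-congˡ (det-rowMatrix-toList (fromList (mergedRows id k)) (tabulate mergedRow) merged) ⟩
    Π * det R (rowMatrix (tabulate mergedRow)) ≈⟨ *-congˡ (det-cong barM≈) ⟩
    Π * det R (barM R A λ' d)                ≈⟨ *-comm _ _ ⟩
    det R (barM R A λ' d) * Π                ∎
    where
    open import Relation.Binary.Reasoning.Setoid setoid
    k : Fin L → ℕ
    k i = d i ∸ 1
    Π = prodF R (λ i → pow R (λ' i) (k i))
    blockRow : Fin (total d) → Row
    blockRow p = (block d p , 1#)
    mergedRow : Fin L → Row
    mergedRow i = (i , fromℕ R (d i))
    blocks : toList (tabulate blockRow) ≡ toList (fromList (blockRows id k ++ []))
    blocks = P.trans (blockRows-tabulate id d d≥1)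
                     (P.trans (P.sym (LP.++-identityʳ _)) (P.sym (VP.toList∘fromList _)))
    merged : toList (fromList (mergedRows id k)) ≡ toList (tabulate mergedRow)
    merged = P.trans (VP.toList∘fromList _) (P.sym (mergedRows-tabulate id d d≥1))
    bigM≈ : ∀ p q → bigM R A λ' d p q ≈ rowMatrix (tabulate blockRow) p q
    bigM≈ p q rewrite VP.lookup∘tabulate blockRow p | VP.lookup∘tabulate blockRow q = +-congʳ (sym (*-identityˡ _))
    barM≈ : ∀ p q → rowMatrix (tabulate mergedRow) p q ≈ barM R A λ' d p q
    barM≈ p q rewrite VP.lookup∘tabulate mergedRow p | VP.lookup∘tabulate mergedRow q = refl

module _ {c ℓ} (R : CommutativeRing c ℓ) where
  open CommutativeRing R hiding (zero)
  open Determinant R using (det-cong)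
  open IntegerCoefficientSolver R using (solve; _:+_; _:*_; :-_; _:=_; con)
  open import Algebra.Properties.Ring ring using (-‿distribʳ-*)

  δ-sub : ∀ {n} (p q : Fin n) t a x → δ R p q t - (a + δ R p q x) ≈ - a + δ R p q (t - x)
  δ-sub p q t a x with p ≟ q
  ... | yes _ = solve 3 (λ t a x → t :+ :- (a :+ x) := :- a :+ (t :+ :- x)) refl t a x
  ... | no  _ = solve 1 (λ a → con (+ 0) :+ :- (a :+ con (+ 0)) := :- a :+ con (+ 0)) refl a

  charPoly-bigM : ∀ {l} (A : Matrix R l) λ' d t →
                  charPoly R (bigM R A λ' d) t ≈ det R (bigM R (λ i j → - A i j) (λ i → t - λ' i) d)
  charPoly-bigM A λ' d t = det-cong λ p q → δ-sub p q t (A (block d p) (block d q)) (λ' (block d p))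

  charPoly-barM : ∀ {l} (A : Matrix R l) λ' d t →
                  charPoly R (barM R A λ' d) t ≈ det R (barM R (λ i j → - A i j) (λ i → t - λ' i) d)
  charPoly-barM A λ' d t = det-cong λ i j →
    trans (δ-sub i j t (fromℕ R (d i) * A i j) (λ' i)) (+-congʳ (-‿distribʳ-* (fromℕ R (d i)) (A i j)))

theorem2p11 : ∀ {c ℓ} (R : CommutativeRing c ℓ) → let open CommutativeRing R in
    (l : ℕ) (A : Fin l → Fin l → Carrier) (λ' : Fin l → Carrier) (d : Fin l → ℕ) →
    (∀ i → 1 ≤ d i) →
    (∀ (t : Carrier) →
      charPoly R (bigM R A λ' d) t
        ≈ charPoly R (barM R A λ' d) t * prodF R (λ i → pow R (t - λ' i) (d i ∸ 1)))
    × (det R (bigM R A λ' d)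
        ≈ det R (barM R A λ' d) * prodF R (λ i → pow R (λ' i) (d i ∸ 1)))
theorem2p11 R l A λ' d d≥1 = charPoly-identity , det-bigM R A λ' d d≥1
  where
  open CommutativeRing R
  open import Relation.Binary.Reasoning.Setoid setoid
  charPoly-identity : ∀ t → charPoly R (bigM R A λ' d) t
                            ≈ charPoly R (barM R A λ' d) t * prodF R (λ i → pow R (t - λ' i) (d i ∸ 1))
  charPoly-identity t = begin
    charPoly R (bigM R A λ' d) t                        ≈⟨ charPoly-bigM R A λ' d t ⟩
    det R (bigM R (λ i j → - A i j) (λ i → t - λ' i) d) ≈⟨ det-bigM R (λ i j → - A i j) (λ i → t - λ' i) d d≥1 ⟩
    det R (barM R (λ i j → - A i j) (λ i → t - λ' i) d) * prodF R (λ i → pow R (t - λ' i) (d i ∸ 1))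
      ≈⟨ *-congʳ (charPoly-barM R A λ' d t) ⟨
    charPoly R (barM R A λ' d) t * prodF R (λ i → pow R (t - λ' i) (d i ∸ 1)) ∎
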